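{- Every distance critical graph on $n \ge 6$ vertices has maximum degree at most $n-4$.
   Context: All graphs are finite, simple and undirected. For vertices $x,y$ of a graph $G$, $d_G(x,y)$ is the length of a shortest path from $x$ to $y$ in $G$ ($\infty$ if none exists). A graph $G$ is distance critical if for every vertex $v \in V(G)$ there exist vertices $x,y \in V(G)\setminus\{v\}$ with $d_G(x,y) \neq d_{G-v}(x,y)$. -}

module Defs where

open import Data.Bool using (Bool; true; false)
open import Data.Nat using (ℕ; zero; suc; _<_)
open import Data.Fin using (Fin; punchIn)
open import Data.List using (length; filterᵇ; allFin)
open import Data.Product using (Σ; ∃; ∃-syntax; _×_)
open import Data.Unit using (⊤)
open import Relation.Nullary using (¬_)
open import Relation.Binary.PropositionalEquality using (_≡_)
open import Function.Bundles using (_⇔_)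

record Graph (n : ℕ) : Set where
  field
    adj   : Fin n → Fin n → Bool
    sym   : ∀ x y → adj x y ≡ adj y x
    irrefl : ∀ x → adj x x ≡ false
open Graph public

degree : ∀ {n} → Graph n → Fin n → ℕ
degree {n} G v = length (filterᵇ (adj G v) (allFin n))

data Walk {n : ℕ} (G : Graph n) : Fin n → Fin n → ℕ → Set where
  here : ∀ {x} → Walk G x x 0
  step : ∀ {x z y k} → adj G x z ≡ true → Walk G z y k → Walk G x y (suc k)

-- d_G(x,y) = k  (k is the length of a shortest x–y walk/path).
-- If no x–y path exists, d_G(x,y) = ∞, i.e. IsDist G x y k holds for no k.
IsDist : ∀ {n} → Graph n → Fin n → Fin n → ℕ → Set
IsDist G x y k = Walk G x y k × (∀ m → m < k → ¬ Walk G x y m)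

DistDiffers : ∀ {n m} → Graph n → Fin n → Fin n → Graph m → Fin m → Fin m → Set
DistDiffers G x y H x' y' = ¬ (∀ k → IsDist G x y k ⇔ IsDist H x' y' k)

-- G - v : delete vertex v; vertices of G - v are identified with Fin n via punchIn v
delete : ∀ {n} → Graph (suc n) → Fin (suc n) → Graph n
delete G v = record
  { adj = λ x y → adj G (punchIn v x) (punchIn v y)
  ; sym = λ x y → sym G (punchIn v x) (punchIn v y)
  ; irrefl = λ x → irrefl G (punchIn v x)
  }

-- distance critical: for every v there are x, y ≠ v with d_G(x,y) ≠ d_{G-v}(x,y).
-- (The vertices of V(G) ∖ {v} are exactly the punchIn v x for x : Fin n.)
DistanceCritical : ∀ {n} → Graph n → Set
DistanceCritical {zero} G = ⊤
DistanceCritical {suc n} G =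
  ∀ (v : Fin (suc n)) → ∃[ x ] ∃[ y ]
    DistDiffers G (punchIn v x) (punchIn v y) (delete G v) x y

-- Deleting u changes some distance only if u is the unique common neighbour of two
-- non-adjacent neighbours p, q (a critical pair at u): otherwise every walk through u
-- is rerouted around u at no extra cost.  So every vertex of a distance critical graph
-- has a critical pair.  Suppose deg v ≥ n - 3, so that at most two vertices are far
-- from v (neither equal nor adjacent to v).  A critical pair at u ≠ v contains a far
-- vertex, since otherwise v would be a second common neighbour, or v is in the pair and
-- its partner is far.  Hence there are exactly two far vertices r ~ s, every vertex
-- other than v is adjacent to r or s, and r, s have common neighbours w_r, w_s with v.
-- As n ≥ 6, v has a neighbour u ∉ {w_r, w_s}, and u has no critical pair (r, q):
-- q = v makes w_r a second common neighbour, q ~ s makes s = u adjacent to v, and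
-- q ~ r contradicts r ≁ q.  Symmetrically for s.
module Submission where

open import Defs
open import Data.Bool using (Bool; true; false)
open import Data.Bool.Properties using () renaming (_≟_ to _≟ᵇ_)
open import Data.Nat using (ℕ; zero; suc; _≤_; _≰_; _<_; _∸_; _+_; z≤n; s≤s; _≤?_)
open import Data.Nat.Properties
  using (≤-trans; ≤-refl; ≤-reflexive; ≤-<-trans; +-suc; +-monoʳ-≤; +-mono-≤; ∸-monoˡ-≤; m≤n⇒m<n∨m≡n; m+n≤o⇒m≤o∸n; m+[n∸m]≡n; module ≤-Reasoning)
open import Data.Fin using (Fin; zero; suc; _≟_; punchIn; punchOut)
open import Data.Fin.Properties using (punchIn-injective; punchInᵢ≢i; punchIn-punchOut; any?; all?)
open import Data.Fin.Subset using (Subset; inside; outside; ∣_∣; _∈_; _∉_; _⊆_; _∪_; ⁅_⁆; ∁; _-_)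
open import Data.Fin.Subset.Properties
  using (∣p∣≤n; ∣p∣≤∣x∷p∣; ∣∁p∣≡n∸∣p∣; x∉p⇒x∈∁p; x∈p∧x≢y⇒x∈p-y; x∈p⇒∣p-x∣<∣p∣; p⊆q⇒∣p∣≤∣q∣; x∈p∪q⁺; x∈⁅x⁆; ∣⁅x⁆∣≡1)
open import Data.List as List using (List; []; _∷_; length; filterᵇ)
open import Data.List.Relation.Unary.All as All using (All; []; _∷_)
open import Data.List.Relation.Unary.Unique.Propositional using (Unique; []; _∷_)
open import Data.Vec as Vec using (_∷_)
open import Data.Vec.Properties using (lookup∘tabulate; []=⇒lookup)
open import Data.Product using (Σ-syntax; ∃-syntax; _×_; _,_; proj₁; proj₂)
open import Data.Sum using (_⊎_; inj₁; inj₂)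
open import Data.Empty using (⊥; ⊥-elim)
open import Function using (_∘_; id; case_of_)
open import Function.Bundles using (_⇔_; mk⇔)
open import Relation.Nullary using (¬_; Dec; yes; no; contradiction)
open import Relation.Nullary.Decidable using (_×-dec_; _→-dec_; ¬?; map′; decidable-stable)
open import Relation.Binary.PropositionalEquality as ≡ using (_≡_; _≢_; refl; cong; cong₂; ≢-sym)

length-filterᵇ-tabulate : ∀ {m n} (f : Fin n → Bool) (g : Fin m → Fin n) →
  length (filterᵇ f (List.tabulate g)) ≡ ∣ Vec.tabulate (f ∘ g) ∣
length-filterᵇ-tabulate {zero}  f g = refl
length-filterᵇ-tabulate {suc m} f g with f (g zero)
... | true  = cong suc (length-filterᵇ-tabulate f (g ∘ suc))
... | false = length-filterᵇ-tabulate f (g ∘ suc)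

∣p∪q∣≤∣p∣+∣q∣ : ∀ {n} (p q : Subset n) → ∣ p ∪ q ∣ ≤ ∣ p ∣ + ∣ q ∣
∣p∪q∣≤∣p∣+∣q∣ Vec.[]        Vec.[]       = z≤n
∣p∪q∣≤∣p∣+∣q∣ (inside  ∷ p) (x ∷ q)      = s≤s (≤-trans (∣p∪q∣≤∣p∣+∣q∣ p q) (+-monoʳ-≤ ∣ p ∣ (∣p∣≤∣x∷p∣ x q)))
∣p∪q∣≤∣p∣+∣q∣ (outside ∷ p) (inside ∷ q) = ≤-trans (s≤s (∣p∪q∣≤∣p∣+∣q∣ p q)) (≤-reflexive (≡.sym (+-suc ∣ p ∣ ∣ q ∣)))
∣p∪q∣≤∣p∣+∣q∣ (outside ∷ p) (outside ∷ q) = ∣p∪q∣≤∣p∣+∣q∣ p q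

length≤∣p∣ : ∀ {n} {p : Subset n} {xs : List (Fin n)} → Unique xs → All (_∈ p) xs → length xs ≤ ∣ p ∣
length≤∣p∣ [] [] = z≤n
length≤∣p∣ {p = p} {x ∷ xs} (x≢xs ∷ xs!) (x∈p ∷ xs⊆p) = ≤-trans (s≤s (length≤∣p∣ xs! xs⊆p-x)) (x∈p⇒∣p-x∣<∣p∣ x∈p)
  where
  xs⊆p-x : All (_∈ p - x) xs
  xs⊆p-x = All.zipWith (λ (y∈p , x≢y) → x∈p∧x≢y⇒x∈p-y y∈p (≢-sym x≢y)) (xs⊆p , x≢xs)

∣p∣≤n∸length : ∀ {n} {p : Subset n} {xs : List (Fin n)} → Unique xs → All (_∉ p) xs → ∣ p ∣ ≤ n ∸ length xs
∣p∣≤n∸length {n} {p} {xs} xs! xs∉p = m+n≤o⇒m≤o∸n ∣ p ∣ (begin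
  ∣ p ∣ + length xs     ≤⟨ +-monoʳ-≤ ∣ p ∣ (length≤∣p∣ xs! (All.map x∉p⇒x∈∁p xs∉p)) ⟩
  ∣ p ∣ + ∣ ∁ p ∣       ≡⟨ cong (∣ p ∣ +_) (∣∁p∣≡n∸∣p∣ p) ⟩
  ∣ p ∣ + (n ∸ ∣ p ∣)   ≡⟨ m+[n∸m]≡n (∣p∣≤n p) ⟩
  n                     ∎)
  where open ≤-Reasoning

module Adjacency {n : ℕ} (G : Graph n) where

  infix 4 _~_ _~?_

  _~_ : Fin n → Fin n → Set
  x ~ y = adj G x y ≡ true

  _~?_ : ∀ x y → Dec (x ~ y)
  x ~? y = adj G x y ≟ᵇ true

  ~-sym : ∀ {x y} → x ~ y → y ~ x
  ~-sym {x} {y} x~y = ≡.trans (sym G y x) x~y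

  ~-irrefl : ∀ {x} → ¬ x ~ x
  ~-irrefl {x} x~x with () ← ≡.trans (≡.sym x~x) (irrefl G x)

  ~⇒≢ : ∀ {x y} → x ~ y → x ≢ y
  ~⇒≢ x~y refl = ~-irrefl x~y

module _ {n : ℕ} (G : Graph n) where
  open Adjacency G

  record CriticalPair (u : Fin n) : Set where
    field
      {p q}  : Fin n
      u~p    : u ~ p
      u~q    : u ~ q
      p≢q    : p ≢ q
      p≁q    : ¬ p ~ q
      unique : ∀ {z} → p ~ z → z ~ q → z ≡ u

  swap : ∀ {u} → CriticalPair u → CriticalPair u
  swap P = record
    { u~p = u~q ; u~q = u~p ; p≢q = ≢-sym p≢q ; p≁q = p≁q ∘ ~-sym
    ; unique = λ q~z z~p → unique (~-sym z~p) (~-sym q~z) }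
    where open CriticalPair P

  criticalPair? : ∀ u → Dec (CriticalPair u)
  criticalPair? u = map′ fromΣ toΣ
    (any? λ p → any? λ q → u ~? p ×-dec u ~? q ×-dec ¬? (p ≟ q) ×-dec ¬? (p ~? q) ×-dec
      all? λ z → p ~? z →-dec z ~? q →-dec z ≟ u)
    where
    Witness : Set
    Witness = ∃[ p ] ∃[ q ] (u ~ p × u ~ q × p ≢ q × ¬ p ~ q × (∀ z → p ~ z → z ~ q → z ≡ u))
    fromΣ : Witness → CriticalPair u
    fromΣ (_ , _ , u~p , u~q , p≢q , p≁q , unique) =
      record { u~p = u~p ; u~q = u~q ; p≢q = p≢q ; p≁q = p≁q ; unique = λ {z} → unique z }
    toΣ : CriticalPair u → Witness
    toΣ P = _ , _ , u~p , u~q , p≢q , p≁q , λ z → unique {z}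
      where open CriticalPair P

_++ʷ_ : ∀ {n} {G : Graph n} {x y z i j} → Walk G x y i → Walk G y z j → Walk G x z (i + j)
here        ++ʷ w = w
step e w₁   ++ʷ w = step e (w₁ ++ʷ w)

leastAgree : ∀ {ℓ} {P Q : ℕ → Set ℓ} → (∀ {k} → Q k → P k) → (∀ {k} → P k → ∃[ m ] m ≤ k × Q m) →
  ∀ k → (P k × (∀ m → m < k → ¬ P m)) ⇔ (Q k × (∀ m → m < k → ¬ Q m))
leastAgree {P = P} {Q} Q⇒P shorten k = mk⇔ to from
  where
  to : P k × (∀ m → m < k → ¬ P m) → Q k × (∀ m → m < k → ¬ Q m)
  to (Pk , least) with shorten Pk
  ... | m , m≤k , Qm with m≤n⇒m<n∨m≡n m≤k
  ...   | inj₁ m<k  = contradiction (Q⇒P Qm) (least m m<k)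
  ...   | inj₂ refl = Qm , λ j j<m → least j j<m ∘ Q⇒P
  from : Q k × (∀ m → m < k → ¬ Q m) → P k × (∀ m → m < k → ¬ P m)
  from (Qk , least) = Q⇒P Qk , λ j j<k Pj →
    let i , i≤j , Qi = shorten Pj in least i (≤-<-trans i≤j j<k) Qi

data PunchView {n} (u : Fin (suc n)) : Fin (suc n) → Set where
  at      : PunchView u u
  punched : ∀ z → PunchView u (punchIn u z)

punchView : ∀ {n} (u z : Fin (suc n)) → PunchView u z
punchView u z with u ≟ z
... | yes refl = at
... | no u≢z   = ≡.subst (PunchView u) (punchIn-punchOut u≢z) (punched (punchOut u≢z))

module Deletion {n : ℕ} (G : Graph (suc n)) (u : Fin (suc n)) where
  open Adjacency G

  private
    H : Graph n
    H = delete G u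

  lift : ∀ {x y k} → Walk H x y k → Walk G (punchIn u x) (punchIn u y) k
  lift here       = here
  lift (step e w) = step e (lift w)

  Bypassable : Set
  Bypassable = ∀ {x y} → u ~ punchIn u x → u ~ punchIn u y → ∃[ m ] m ≤ 2 × Walk H x y m

  shorten : Bypassable → ∀ {a b k} → Walk G a b k → ∀ {x y} → a ≡ punchIn u x → b ≡ punchIn u y →
    ∃[ m ] m ≤ k × Walk H x y m
  shorten _ here {x} {y} refl b≡y = 0 , z≤n , ≡.subst (λ t → Walk H x t 0) (punchIn-injective u x y b≡y) here
  shorten bypass (step {z = z} a~z w) refl b≡y with punchView u z
  ... | punched _ = let m , m≤k , w′ = shorten bypass w refl b≡y in suc m , s≤s m≤k , step a~z w′
  shorten bypass (step a~u here) {y = y} refl b≡y | at = ⊥-elim (punchInᵢ≢i u y (≡.sym b≡y))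
  shorten bypass (step a~u (step {z = z} u~z w)) refl b≡y | at with punchView u z
  ... | at        = ⊥-elim (~-irrefl u~z)
  ... | punched _ =
    let i , i≤2 , detour = bypass (~-sym a~u) u~z
        j , j≤k , rest   = shorten bypass w refl b≡y
    in i + j , +-mono-≤ i≤2 j≤k , detour ++ʷ rest

  ¬criticalPair⇒bypassable : ¬ CriticalPair G u → Bypassable
  ¬criticalPair⇒bypassable noPair {x} {y} u~x u~y with x ≟ y
  ... | yes refl = 0 , z≤n , here
  ... | no x≢y with punchIn u x ~? punchIn u y
  ...   | yes x~y = 1 , s≤s z≤n , step x~y here
  ...   | no x≁y with any? (λ z → punchIn u x ~? punchIn u z ×-dec punchIn u z ~? punchIn u y)
  ...     | yes (_ , x~z , z~y) = 2 , ≤-refl , step x~z (step z~y here)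
  ...     | no noCommon = contradiction pair noPair
    where
    onlyU : ∀ {z} → punchIn u x ~ z → z ~ punchIn u y → z ≡ u
    onlyU {z} x~z z~y with punchView u z
    ... | at         = refl
    ... | punched z′ = contradiction (z′ , x~z , z~y) noCommon
    pair : CriticalPair G u
    pair = record
      { u~p = u~x ; u~q = u~y ; p≢q = x≢y ∘ punchIn-injective u x y ; p≁q = x≁y ; unique = onlyU }

  bypassable⇒distancesPreserved : Bypassable → ∀ x y → ¬ DistDiffers G (punchIn u x) (punchIn u y) H x y
  bypassable⇒distancesPreserved bypass x y differs = differs (leastAgree lift λ w → shorten bypass w refl refl)

distanceCritical⇒criticalPair : ∀ {n} (G : Graph (suc n)) → DistanceCritical G → ∀ u → CriticalPair G u
distanceCritical⇒criticalPair G critical u = decidable-stable (criticalPair? G u) λ noPair →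
  let x , y , differs = critical u
  in bypassable⇒distancesPreserved (¬criticalPair⇒bypassable noPair) x y differs
  where open Deletion G u

neighbourhood : ∀ {n} → Graph n → Fin n → Subset n
neighbourhood G v = Vec.tabulate (adj G v)

module _ {n : ℕ} (G : Graph n) (v : Fin n) where
  open Adjacency G

  degree≡∣neighbourhood∣ : degree G v ≡ ∣ neighbourhood G v ∣
  degree≡∣neighbourhood∣ = length-filterᵇ-tabulate (adj G v) id

  ∈-neighbourhood⁻ : ∀ {x} → x ∈ neighbourhood G v → v ~ x
  ∈-neighbourhood⁻ {x} x∈N = ≡.trans (≡.sym (lookup∘tabulate (adj G v) x)) ([]=⇒lookup x∈N)

  degree≤n∸length : ∀ {xs} → Unique xs → All (λ x → ¬ v ~ x) xs → degree G v ≤ n ∸ length xs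
  degree≤n∸length xs! xs≁v =
    ≤-trans (≤-reflexive degree≡∣neighbourhood∣) (∣p∣≤n∸length xs! (All.map (_∘ ∈-neighbourhood⁻) xs≁v))

  degree≤2 : ∀ {w w′} → (∀ {x} → v ~ x → x ≡ w ⊎ x ≡ w′) → degree G v ≤ 2
  degree≤2 {w} {w′} within = begin
    degree G v                 ≡⟨ degree≡∣neighbourhood∣ ⟩
    ∣ neighbourhood G v ∣      ≤⟨ p⊆q⇒∣p∣≤∣q∣ N⊆ww′ ⟩
    ∣ ⁅ w ⁆ ∪ ⁅ w′ ⁆ ∣          ≤⟨ ∣p∪q∣≤∣p∣+∣q∣ ⁅ w ⁆ ⁅ w′ ⁆ ⟩
    ∣ ⁅ w ⁆ ∣ + ∣ ⁅ w′ ⁆ ∣      ≡⟨ cong₂ _+_ (∣⁅x⁆∣≡1 w) (∣⁅x⁆∣≡1 w′) ⟩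
    2                          ∎
    where
    open ≤-Reasoning
    N⊆ww′ : neighbourhood G v ⊆ ⁅ w ⁆ ∪ ⁅ w′ ⁆
    N⊆ww′ x∈N with within (∈-neighbourhood⁻ x∈N)
    ... | inj₁ refl = x∈p∪q⁺ (inj₁ (x∈⁅x⁆ w))
    ... | inj₂ refl = x∈p∪q⁺ (inj₂ (x∈⁅x⁆ w′))

module DenseVertex {n : ℕ} (G : Graph n) (critical : ∀ u → CriticalPair G u)
                   (v : Fin n) (large : degree G v ≰ n ∸ 4) where
  open Adjacency G
  open CriticalPair

  Far : Fin n → Set
  Far x = x ≢ v × ¬ v ~ x

  farMember : ∀ {u} → u ≢ v → (P : CriticalPair G u) → Far (p P) ⊎ Far (q P)
  farMember u≢v record { p = p ; q = q ; p≢q = p≢q ; p≁q = p≁q ; unique = unique } with p ≟ v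
  ... | yes refl = inj₂ (≢-sym p≢q , p≁q)
  ... | no p≢v with v ~? p
  ...   | no v≁p = inj₁ (p≢v , v≁p)
  ...   | yes v~p with q ≟ v
  ...     | yes refl = contradiction (~-sym v~p) p≁q
  ...     | no q≢v with v ~? q
  ...       | no v≁q  = inj₂ (q≢v , v≁q)
  ...       | yes v~q = contradiction (≡.sym (unique (~-sym v~p) v~q)) u≢v

  farCriticalPair : ∀ {u} → u ≢ v → Σ[ P ∈ CriticalPair G u ] Far (p P)
  farCriticalPair {u} u≢v with farMember u≢v (critical u)
  ... | inj₁ far-p = critical u , far-p
  ... | inj₂ far-q = swap G (critical u) , far-q

  farNeighbour : ∀ {u} → u ≢ v → ∃[ r ] Far r × u ~ r
  farNeighbour u≢v = let P , far-p = farCriticalPair u≢v in p P , far-p , u~p P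

  atMostTwoFar : ∀ {r s x} → Far r → Far s → r ≢ s → Far x → x ≡ r ⊎ x ≡ s
  atMostTwoFar {r} {s} {x} (r≢v , v≁r) (s≢v , v≁s) r≢s (x≢v , v≁x) with x ≟ r | x ≟ s
  ... | yes x≡r | _       = inj₁ x≡r
  ... | no _    | yes x≡s = inj₂ x≡s
  ... | no x≢r  | no x≢s  = contradiction (degree≤n∸length G v distinct nonNeighbours) large
    where
    distinct : Unique (v ∷ r ∷ s ∷ x ∷ [])
    distinct = (≢-sym r≢v ∷ ≢-sym s≢v ∷ ≢-sym x≢v ∷ []) ∷ (r≢s ∷ ≢-sym x≢r ∷ []) ∷ (≢-sym x≢s ∷ []) ∷ [] ∷ []
    nonNeighbours : All (λ y → ¬ v ~ y) (v ∷ r ∷ s ∷ x ∷ [])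
    nonNeighbours = ~-irrefl ∷ v≁r ∷ v≁s ∷ v≁x ∷ []

  adjacentToFar : ∀ {r s} → Far r → Far s → r ≢ s → ∀ {x} → x ≢ v → x ~ r ⊎ x ~ s
  adjacentToFar far-r far-s r≢s x≢v with farNeighbour x≢v
  ... | y , far-y , x~y with atMostTwoFar far-r far-s r≢s far-y
  ...   | inj₁ refl = inj₁ x~y
  ...   | inj₂ refl = inj₂ x~y

  farCommonNeighbour : ∀ {r} → Far r → ∃[ w ] r ~ w × v ~ w
  farCommonNeighbour {r} far-r@(r≢v , _) =
    let P , far-s = farCriticalPair r≢v in q P , u~q P , partnerAdjacent P far-s
    where
    partnerAdjacent : (P : CriticalPair G r) → Far (p P) → v ~ q P
    partnerAdjacent record { q = w ; u~p = r~s ; u~q = r~w ; p≢q = s≢w } far-s with v ~? w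
    ... | yes v~w = v~w
    ... | no v≁w with atMostTwoFar far-r far-s (~⇒≢ r~s) ((λ { refl → proj₂ far-r (~-sym r~w) }) , v≁w)
    ...   | inj₁ refl = contradiction r~w ~-irrefl
    ...   | inj₂ refl = contradiction refl s≢w

  neighbourAvoiding : 6 ≤ n → ∀ w w′ → ∃[ u ] v ~ u × u ≢ w × u ≢ w′
  neighbourAvoiding six w w′ with any? (λ u → v ~? u ×-dec ¬? (u ≟ w) ×-dec ¬? (u ≟ w′))
  ... | yes found = found
  ... | no none   = contradiction (≤-trans (degree≤2 G v within) (∸-monoˡ-≤ 4 six)) large
    where
    within : ∀ {x} → v ~ x → x ≡ w ⊎ x ≡ w′
    within {x} v~x with x ≟ w | x ≟ w′
    ... | yes x≡w | _        = inj₁ x≡w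
    ... | no _    | yes x≡w′ = inj₂ x≡w′
    ... | no x≢w  | no x≢w′  = contradiction (x , v~x , x≢w , x≢w′) none

  notCriticalThrough : ∀ {r s w} → Far r → Far s → r ~ s → r ~ w → v ~ w →
    ∀ {u} → v ~ u → u ≢ w → (C : CriticalPair G u) → p C ≢ r
  notCriticalThrough far-r far-s@(_ , v≁s) r~s r~w v~w v~u u≢w
    record { q = q ; p≁q = r≁q ; unique = unique } refl with q ≟ v
  ... | yes refl = u≢w (≡.sym (unique r~w (~-sym v~w)))
  ... | no q≢v with adjacentToFar far-r far-s (~⇒≢ r~s) q≢v
  ...   | inj₁ q~r = r≁q (~-sym q~r)
  ...   | inj₂ q~s = v≁s (≡.subst (v ~_) (≡.sym (unique r~s (~-sym q~s))) v~u)

  impossible : 6 ≤ n → ⊥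
  impossible six =
    let r , far-r , _        = farNeighbour (≢-sym (~⇒≢ (u~p (critical v))))
        s , far-s , r~s      = farNeighbour (proj₁ far-r)
        w′ , r~w′ , v~w′     = farCommonNeighbour far-r
        w , s~w , v~w        = farCommonNeighbour far-s
        u , v~u , u≢w , u≢w′ = neighbourAvoiding six w w′
        C , far-c            = farCriticalPair (≢-sym (~⇒≢ v~u))
    in case atMostTwoFar far-r far-s (~⇒≢ r~s) far-c of λ where
         (inj₁ c≡r) → notCriticalThrough far-r far-s r~s r~w′ v~w′ v~u u≢w′ C c≡r
         (inj₂ c≡s) → notCriticalThrough far-s far-r (~-sym r~s) s~w v~w v~u u≢w C c≡s

lemma5p2 : (n : ℕ) → 6 ≤ n → (G : Graph n) → DistanceCritical G →
    (v : Fin n) → degree G v ≤ n ∸ 4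
lemma5p2 (suc n) six G distanceCritical v = decidable-stable (degree G v ≤? suc n ∸ 4) λ large →
  DenseVertex.impossible G (distanceCritical⇒criticalPair G distanceCritical) v large six
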